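{- Let $w,u$ be step sequences over a comtrace alphabet $\Theta=(\Sigma,\mathit{sim},\mathit{ser})$. Then $w\equiv_\Theta u$ if and only if $\Pi^\perp_{a,b}(w)=\Pi^\perp_{a,b}(u)$ for all $(a,b)\in(\Sigma\times\Sigma)\setminus\mathit{ind}$.
   Context: A comtrace alphabet is $\Theta=(\Sigma,\mathit{sim},\mathit{ser})$ with $\Sigma$ finite nonempty, $\mathit{ser}\subseteq\mathit{sim}\subseteq\Sigma\times\Sigma$, $\mathit{sim}$ irreflexive and symmetric. Steps: nonempty $A\subseteq\Sigma$ with $(a,b)\in\mathit{sim}$ for distinct $a,b\in A$. $\equiv_\Theta$ is the reflexive, symmetric, transitive closure of $uABz\sim_\Theta u(A\cup B)z$ for steps $A,B$ with $A\times B\subseteq\mathit{ser}$. Derived relations: $\mathit{ind}=\mathit{ser}\cap\mathit{ser}^{ -1}$, $\mathit{ssm}=\mathit{sim}\setminus(\mathit{ser}\cup\mathit{ser}^{ -1})$, $\mathit{wdp}=\mathit{ser}^{ -1}\setminus\mathit{ser}$. Let $\perp\notin\Sigma$ be a new symbol. For $(a,b)\notin\mathit{ind}$ (possibly $a=b$) and a step $A$, define $\Pi^\perp_{a,b}(A)\in(\Sigma\cup\{\perp\})^*$ by: $\epsilon$ if $\{a,b\}\cap A=\emptyset$; $a$ if $a\in A$, $b\notin A$; $b$ if $b\in A$, $a\notin A$; $a$ if $a=b\in A$; and for $a\neq b$ both in $A$: $ba$ if $(a,b)\in\mathit{wdp}$, $ab$ if $(b,a)\in\mathit{wdp}$, $\perp$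 if $(a,b)\in\mathit{ssm}$. For a step sequence $A_1\ldots A_n$, $\Pi^\perp_{a,b}(A_1\ldots A_n)=\Pi^\perp_{a,b}(A_1)\cdots\Pi^\perp_{a,b}(A_n)$. -}

module Defs where

open import Data.Bool using (Bool; true; false; if_then_else_; _∧_; not)
open import Data.Nat using (ℕ; suc)
open import Data.Fin using (Fin; _≟_)
open import Data.Fin.Subset using (Subset; _∈_; _∪_; Nonempty)
open import Data.Fin.Subset.Properties using (_∈?_)
open import Data.List using (List; []; _∷_; _++_; [_]; concatMap)
open import Data.List.Relation.Unary.All using (All)
open import Data.Maybe using (Maybe; just; nothing)
open import Data.Product using (_×_)
open import Relation.Binary.PropositionalEquality using (_≡_; _≢_)
open import Relation.Binary.Construct.Closure.Equivalence using (EqClosure)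
open import Relation.Nullary using (yes; no)

record ComtraceAlphabet (m : ℕ) : Set where
  field
    sim : Fin (suc m) → Fin (suc m) → Bool
    ser : Fin (suc m) → Fin (suc m) → Bool
    ser⊆sim : ∀ a b → ser a b ≡ true → sim a b ≡ true
    sim-irrefl : ∀ a → sim a a ≡ false
    sim-sym : ∀ a b → sim a b ≡ sim b a

module _ {m : ℕ} (Θ : ComtraceAlphabet m) where
  open ComtraceAlphabet Θ

  Letter : Set
  Letter = Fin (suc m)

  Ind : Letter → Letter → Set
  Ind a b = (ser a b ≡ true) × (ser b a ≡ true)

  IsStep : Subset (suc m) → Set
  IsStep A = Nonempty A × (∀ a b → a ∈ A → b ∈ A → a ≢ b → sim a b ≡ true)

  IsStepSeq : List (Subset (suc m)) → Set
  IsStepSeq = All IsStep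

  data _∼_ : List (Subset (suc m)) → List (Subset (suc m)) → Set where
    merge : ∀ u A B z → IsStepSeq u → IsStep A → IsStep B → IsStepSeq z →
            (∀ a b → a ∈ A → b ∈ B → ser a b ≡ true) →
            (u ++ A ∷ B ∷ z) ∼ (u ++ (A ∪ B) ∷ z)

  _≡Θ_ : List (Subset (suc m)) → List (Subset (suc m)) → Set
  _≡Θ_ = EqClosure _∼_

  -- Π^⊥_{a,b} on a single step; ⊥ is represented by `nothing`,
  -- a letter x by `just x`.
  -- For a ≠ b both in A:
  --   (a,b) ∈ wdp  (ser b a ∧ ¬ ser a b)  ↦  b a
  --   (b,a) ∈ wdp  (ser a b ∧ ¬ ser b a)  ↦  a b
  --   otherwise (for a step and (a,b) ∉ ind this is exactly ssm) ↦ ⊥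
  -- (The remaining case (a,b) ∈ ind is never used by the theorem.)
  Πstep : Letter → Letter → Subset (suc m) → List (Maybe Letter)
  Πstep a b A with a ∈? A | b ∈? A
  ... | no _  | no _  = []
  ... | yes _ | no _  = just a ∷ []
  ... | no _  | yes _ = just b ∷ []
  ... | yes _ | yes _ with a ≟ b
  ...   | yes _ = just a ∷ []
  ...   | no _  =
          if ser b a ∧ not (ser a b) then just b ∷ just a ∷ []
          else if ser a b ∧ not (ser b a) then just a ∷ just b ∷ []
          else nothing ∷ []

  Π⊥ : Letter → Letter → List (Subset (suc m)) → List (Maybe Letter)
  Π⊥ a b = concatMap (Πstep a b)

-- Soundness: for a pair (a, b) ∉ ind, a merge u A B z ∼ u (A ∪ B) z with A × B ⊆ ser leaves
-- Π⊥_{a,b} unchanged, since Π⊥_{a,b}(A ∪ B) lists the letters of A before those of B.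
-- Completeness, by induction on w = A w′: if every projection of u begins with that of A, then
-- u ≡ A u′. For u = B v the pieces A ∩ B, B ─ A, A ─ B satisfy (A ∩ B) × (B ─ A) ⊆ ser,
-- (A ∩ B) × (A ─ B) ⊆ ser and (A ─ B) × (B ─ A) ⊆ ind, read off from the first letters of the
-- projections, and every projection of v begins with that of A ─ B; so by induction v ≡ (A ─ B) v₂
-- and B v ≡ (A ∩ B)(B ─ A)(A ─ B) v₂ ≡ (A ∩ B)(A ─ B)(B ─ A) v₂ ≡ A (B ─ A) v₂.
-- Cancelling Π⊥(A) then gives equal projections of w′ and u′.
module Submission where

open import Defs
open import Data.Bool using (Bool; true; false; _∨_; not; _∧_; if_then_else_)
import Data.Bool as Bool
open import Data.Empty using (⊥-elim)
open import Data.Fin using (Fin; _≟_)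
open import Data.Fin.Subset using (Subset; _∈_; _∉_; _∪_; _∩_; _─_; _⊆_; Nonempty; Empty; outside; inside)
open import Data.Fin.Subset.Properties
  using (_∈?_; nonempty?; Empty-unique; ∪-identityˡ; ∪-identityʳ; ∪-comm; ∩-comm; ⊆-antisym;
         x∈p∩q⁺; x∈p∩q⁻; x∈p∪q⁺; x∈p∪q⁻; x∈p∧x∉q⇒x∈p─q; p─q⊆p)
open import Data.List using (List; []; _∷_; _++_; map; concat)
open import Data.List.Properties using (++-assoc; ++-identityʳ; ++-cancelˡ; ∷-injectiveˡ; map-++; concat-++)
open import Data.List.Relation.Unary.All using ([]; _∷_)
open import Data.Maybe using (Maybe; just; nothing)
open import Data.Maybe.Properties using (just-injective)
open import Data.Nat using (ℕ; suc)
open import Data.Product using (_×_; _,_; proj₁; proj₂; ∃)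
open import Data.Sum using (_⊎_; inj₁; inj₂)
open import Data.Vec using (_∷_; there; lookup)
open import Data.Vec.Properties using ([]=⇒lookup; lookup⇒[]=; lookup-zipWith)
open import Function using (_∘_)
open import Function.Bundles using (_⇔_; mk⇔)
open import Relation.Binary.Construct.Closure.Equivalence using (gfold; gmap; setoid)
open import Relation.Binary.Construct.Closure.ReflexiveTransitive using (ε; _◅_)
open import Relation.Binary.Construct.Closure.Symmetric using (fwd)
import Relation.Binary.Reasoning.Setoid as ≈-Reasoning
open import Relation.Binary.PropositionalEquality using (_≡_; _≢_; refl; sym; trans; cong; subst; isEquivalence; module ≡-Reasoning)
open import Relation.Nullary using (¬_; Dec; yes; no; contradiction)
open import Relation.Nullary.Decidable using (_×-dec_)

private
  variable
    n : ℕ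
    x : Fin n
    p q : Subset n

∉⇒lookup≡false : x ∉ p → lookup p x ≡ false
∉⇒lookup≡false {x = x} {p = p} x∉p with lookup p x in eq
... | true  = contradiction (lookup⇒[]= x p eq) x∉p
... | false = refl

x∈p─q⇒x∉q : ∀ (p q : Subset n) → x ∈ p ─ q → x ∉ q
x∈p─q⇒x∉q (_ ∷ p) (outside ∷ q) (there x∈p─q) (there x∈q) = x∈p─q⇒x∉q p q x∈p─q x∈q
x∈p─q⇒x∉q (_ ∷ p) (inside  ∷ q) (there x∈p─q) (there x∈q) = x∈p─q⇒x∉q p q x∈p─q x∈q

p∩q∪p─q≡p : ∀ (p q : Subset n) → p ∩ q ∪ (p ─ q) ≡ p
p∩q∪p─q≡p p q = ⊆-antisym ⊆p p⊆
  where
  ⊆p : p ∩ q ∪ (p ─ q) ⊆ p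
  ⊆p x∈ with x∈p∪q⁻ (p ∩ q) (p ─ q) x∈
  ... | inj₁ x∈p∩q = proj₁ (x∈p∩q⁻ p q x∈p∩q)
  ... | inj₂ x∈p─q = p─q⊆p p q x∈p─q
  p⊆ : p ⊆ p ∩ q ∪ (p ─ q)
  p⊆ {x} x∈p with x ∈? q
  ... | yes x∈q = x∈p∪q⁺ (inj₁ (x∈p∩q⁺ (x∈p , x∈q)))
  ... | no  x∉q = x∈p∪q⁺ (inj₂ (x∈p∧x∉q⇒x∈p─q x∈p x∉q))

p∩q∪q─p≡q : ∀ (p q : Subset n) → p ∩ q ∪ (q ─ p) ≡ q
p∩q∪q─p≡q p q = trans (cong (_∪ (q ─ p)) (∩-comm p q)) (p∩q∪p─q≡p q p)

module _ {m : ℕ} (Θ : ComtraceAlphabet m) where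
  open ComtraceAlphabet Θ

  private
    Step : Set
    Step = Subset (suc m)

    Word : Set
    Word = List Step

    variable
      a b : Letter Θ
      A B X Y : Step
      u v w : Word

    _≈_ : Word → Word → Set
    _≈_ = _≡Θ_ Θ

  ser-irrefl : ser a a ≢ true
  ser-irrefl {a} saa with () ← trans (sym (ser⊆sim a a saa)) (sim-irrefl a)

  ¬Ind-refl : ¬ Ind Θ a a
  ¬Ind-refl = ser-irrefl ∘ proj₁

  Ind-sym : Ind Θ a b → Ind Θ b a
  Ind-sym (sab , sba) = sba , sab

  Ind? : ∀ a b → Dec (Ind Θ a b)
  Ind? a b = (ser a b Bool.≟ true) ×-dec (ser b a Bool.≟ true)

  ¬Ind⇒ser-asym : ¬ Ind Θ a b → ser a b ≡ true → ser b a ≡ false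
  ¬Ind⇒ser-asym {a} {b} ni sab with ser b a
  ... | true  = contradiction (sab , refl) ni
  ... | false = refl

  πboth : Letter Θ → Letter Θ → List (Maybe (Letter Θ))
  πboth a b with a ≟ b
  ... | yes _ = just a ∷ []
  ... | no  _ =
          if ser b a ∧ not (ser a b) then just b ∷ just a ∷ []
          else if ser a b ∧ not (ser b a) then just a ∷ just b ∷ []
          else nothing ∷ []

  πbits : Letter Θ → Letter Θ → Bool → Bool → List (Maybe (Letter Θ))
  πbits a b false false = []
  πbits a b true  false = just a ∷ []
  πbits a b false true  = just b ∷ []
  πbits a b true  true  = πboth a b

  Πstep≡πbits : ∀ a b A → Πstep Θ a b A ≡ πbits a b (lookup A a) (lookup A b)
  Πstep≡πbits a b A with a ∈? A | b ∈? A
  ... | no a∉A | no b∉A rewrite ∉⇒lookup≡false a∉A | ∉⇒lookup≡false b∉A = refl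
  ... | yes a∈A | no b∉A rewrite []=⇒lookup a∈A | ∉⇒lookup≡false b∉A = refl
  ... | no a∉A | yes b∈A rewrite ∉⇒lookup≡false a∉A | []=⇒lookup b∈A = refl
  ... | yes a∈A | yes b∈A rewrite []=⇒lookup a∈A | []=⇒lookup b∈A with a ≟ b
  ...   | yes _ = refl
  ...   | no  _ = refl

  Πstep-∉∉ : a ∉ A → b ∉ A → Πstep Θ a b A ≡ []
  Πstep-∉∉ {a} {A} {b} a∉A b∉A
    rewrite Πstep≡πbits a b A | ∉⇒lookup≡false a∉A | ∉⇒lookup≡false b∉A = refl

  Πstep-∈∉ : a ∈ A → b ∉ A → Πstep Θ a b A ≡ just a ∷ []
  Πstep-∈∉ {a} {A} {b} a∈A b∉A
    rewrite Πstep≡πbits a b A | []=⇒lookup a∈A | ∉⇒lookup≡false b∉A = refl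

  Πstep-∉∈ : a ∉ A → b ∈ A → Πstep Θ a b A ≡ just b ∷ []
  Πstep-∉∈ {a} {A} {b} a∉A b∈A
    rewrite Πstep≡πbits a b A | ∉⇒lookup≡false a∉A | []=⇒lookup b∈A = refl

  Πstep-∈∈ : a ∈ A → b ∈ A → Πstep Θ a b A ≡ πboth a b
  Πstep-∈∈ {a} {A} {b} a∈A b∈A
    rewrite Πstep≡πbits a b A | []=⇒lookup a∈A | []=⇒lookup b∈A = refl

  πboth-refl : ∀ a → πboth a a ≡ just a ∷ []
  πboth-refl a with a ≟ a
  ... | yes _   = refl
  ... | no  a≢a = contradiction refl a≢a

  Πstep-diag : a ∈ A → Πstep Θ a a A ≡ just a ∷ []
  Πstep-diag {a} a∈A = trans (Πstep-∈∈ a∈A a∈A) (πboth-refl a)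

  πboth-ser : a ≢ b → ser a b ≡ true → ser b a ≡ false → πboth a b ≡ just a ∷ just b ∷ []
  πboth-ser {a} {b} a≢b sab sba with a ≟ b
  ... | yes a≡b = contradiction a≡b a≢b
  ... | no  _ rewrite sab | sba = refl

  πboth-ser⁻¹ : a ≢ b → ser b a ≡ true → ser a b ≡ false → πboth a b ≡ just b ∷ just a ∷ []
  πboth-ser⁻¹ {a} {b} a≢b sba sab with a ≟ b
  ... | yes a≡b = contradiction a≡b a≢b
  ... | no  _ rewrite sab | sba = refl

  πboth-head : ∀ {xs ys} → a ≢ b → πboth a b ++ xs ≡ just a ∷ ys → ser a b ≡ true
  πboth-head {a} {b} a≢b eq with a ≟ b
  ... | yes a≡b = contradiction a≡b a≢b
  ... | no  _ with ser a b | ser b a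
  ...   | true  | _     = refl
  ...   | false | true  = contradiction (sym (just-injective (∷-injectiveˡ eq))) a≢b
  ...   | false | false with () ← ∷-injectiveˡ eq

  Serial : Step → Step → Set
  Serial X Y = ∀ a b → a ∈ X → b ∈ Y → ser a b ≡ true

  Independent : Step → Step → Set
  Independent X Y = ∀ a b → a ∈ X → b ∈ Y → Ind Θ a b

  -- The hypotheses say A × B ⊆ ser on {a, b}, where α, β (α′, β′) record whether a, b lie in
  -- A (in B); the diagonal ones make A and B disjoint there, ser being irreflexive.
  πbits-++ : ∀ {α β α′ β′} → ¬ Ind Θ a b → (a ≡ b → α ≡ β) →
             (α ≡ true → α′ ≡ true → ser a a ≡ true) → (β ≡ true → β′ ≡ true → ser b b ≡ true) →
             (α ≡ true → β′ ≡ true → ser a b ≡ true) → (β ≡ true → α′ ≡ true → ser b a ≡ true) →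
             πbits a b α β ++ πbits a b α′ β′ ≡ πbits a b (α ∨ α′) (β ∨ β′)
  πbits-++ {α = false} {false}                 _  _ _ _ _ _ = refl
  πbits-++ {α = true}  {false} {false} {false} _  _ _ _ _ _ = refl
  πbits-++ {α = true}  {false} {false} {true}  ni e _ _ s _ =
    sym (πboth-ser ((λ ()) ∘ e) (s refl refl) (¬Ind⇒ser-asym ni (s refl refl)))
  πbits-++ {α = true}  {false} {true}          _  _ s _ _ _ = contradiction (s refl refl) ser-irrefl
  πbits-++ {α = false} {true}  {false} {false} _  _ _ _ _ _ = refl
  πbits-++ {α = false} {true}  {true}  {false} ni e _ _ _ s =
    sym (πboth-ser⁻¹ ((λ ()) ∘ e) (s refl refl) (¬Ind⇒ser-asym (ni ∘ Ind-sym) (s refl refl)))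
  πbits-++ {α = false} {true}  {_}     {true}  _  _ _ s _ _ = contradiction (s refl refl) ser-irrefl
  πbits-++ {α = true}  {true}  {false} {false} _  _ _ _ _ _ = ++-identityʳ _
  πbits-++ {α = true}  {true}  {true}          _  _ s _ _ _ = contradiction (s refl refl) ser-irrefl
  πbits-++ {α = true}  {true}  {false} {true}  _  _ _ s _ _ = contradiction (s refl refl) ser-irrefl

  Πstep-∪ : ¬ Ind Θ a b → Serial A B → Πstep Θ a b A ++ Πstep Θ a b B ≡ Πstep Θ a b (A ∪ B)
  Πstep-∪ {a} {b} {A} {B} ni s
    rewrite Πstep≡πbits a b A | Πstep≡πbits a b B | Πstep≡πbits a b (A ∪ B)
          | lookup-zipWith _∨_ a A B | lookup-zipWith _∨_ b A B
    = πbits-++ ni (cong (lookup A)) (serial a a) (serial b b) (serial a b) (serial b a)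
    where
    serial : ∀ c d → lookup A c ≡ true → lookup B d ≡ true → ser c d ≡ true
    serial c d c∈A d∈B = s c d (lookup⇒[]= c A c∈A) (lookup⇒[]= d B d∈B)

  Π⊥-++ : ∀ a b u v → Π⊥ Θ a b (u ++ v) ≡ Π⊥ Θ a b u ++ Π⊥ Θ a b v
  Π⊥-++ a b u v = trans (cong concat (map-++ (Πstep Θ a b) u v)) (sym (concat-++ (map (Πstep Θ a b) u) _))

  Π⊥-∼ : ¬ Ind Θ a b → _∼_ Θ u v → Π⊥ Θ a b u ≡ Π⊥ Θ a b v
  Π⊥-∼ {a} {b} ni (merge u A B z _ _ _ _ s) = begin
    Π⊥ Θ a b (u ++ A ∷ B ∷ z)                    ≡⟨ Π⊥-++ a b u _ ⟩
    Πu ++ (π A ++ (π B ++ Πz))                   ≡⟨ cong (Πu ++_) (++-assoc (π A) (π B) Πz) ⟨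
    Πu ++ ((π A ++ π B) ++ Πz)                   ≡⟨ cong (λ t → Πu ++ (t ++ Πz)) (Πstep-∪ ni s) ⟩
    Πu ++ (π (A ∪ B) ++ Πz)                      ≡⟨ Π⊥-++ a b u _ ⟨
    Π⊥ Θ a b (u ++ (A ∪ B) ∷ z)                  ∎
    where
    open ≡-Reasoning
    π : Step → List (Maybe (Letter Θ))
    π = Πstep Θ a b
    Πu Πz : List (Maybe (Letter Θ))
    Πu = Π⊥ Θ a b u
    Πz = Π⊥ Θ a b z

  Π⊥-≈ : ¬ Ind Θ a b → u ≈ v → Π⊥ Θ a b u ≡ Π⊥ Θ a b v
  Π⊥-≈ {a} {b} ni = gfold isEquivalence (Π⊥ Θ a b) (Π⊥-∼ ni)

  Simultaneous : Step → Set
  Simultaneous X = ∀ a b → a ∈ X → b ∈ X → a ≢ b → sim a b ≡ true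

  Simultaneous-⊆ : X ⊆ Y → Simultaneous Y → Simultaneous X
  Simultaneous-⊆ X⊆Y simY a b a∈X b∈X = simY a b (X⊆Y a∈X) (X⊆Y b∈X)

  Simultaneous-∩ : Simultaneous X → Simultaneous (X ∩ Y)
  Simultaneous-∩ {X} {Y} = Simultaneous-⊆ (proj₁ ∘ x∈p∩q⁻ X Y)

  Simultaneous-─ : Simultaneous X → Simultaneous (X ─ Y)
  Simultaneous-─ {X} {Y} = Simultaneous-⊆ (p─q⊆p X Y)

  -- The pieces A ∩ B, B ─ A, A ─ B of two steps may be empty, and then they are not steps.
  infixr 5 _∷?_
  _∷?_ : Step → Word → Word
  X ∷? v with nonempty? X
  ... | yes _ = X ∷ v
  ... | no  _ = v

  ∷?-nonempty : Nonempty X → X ∷? v ≡ X ∷ v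
  ∷?-nonempty {X} neX with nonempty? X
  ... | yes _  = refl
  ... | no ¬ne = contradiction neX ¬ne

  ∷?-empty : Empty X → X ∷? v ≡ v
  ∷?-empty {X} ¬neX with nonempty? X
  ... | yes ne = contradiction ne ¬neX
  ... | no  _  = refl

  ∷?-IsStepSeq : Simultaneous X → IsStepSeq Θ v → IsStepSeq Θ (X ∷? v)
  ∷?-IsStepSeq {X} simX sv with nonempty? X
  ... | yes neX = (neX , simX) ∷ sv
  ... | no  _   = sv

  ∼-∷ : IsStep Θ X → _∼_ Θ u v → _∼_ Θ (X ∷ u) (X ∷ v)
  ∼-∷ sX (merge u A B z su sA sB sz s) = merge (_ ∷ u) A B z (sX ∷ su) sA sB sz s

  ≈-∷ : IsStep Θ X → u ≈ v → (X ∷ u) ≈ (X ∷ v)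
  ≈-∷ {X} sX = gmap (X ∷_) (∼-∷ sX)

  ≈-∷? : Simultaneous X → u ≈ v → (X ∷? u) ≈ (X ∷? v)
  ≈-∷? {X} simX u≈v with nonempty? X
  ... | yes neX = ≈-∷ (neX , simX) u≈v
  ... | no  _   = u≈v

  ∷?-merge : Simultaneous X → Simultaneous Y → Serial X Y → IsStepSeq Θ v →
             (X ∷? Y ∷? v) ≈ ((X ∪ Y) ∷? v)
  ∷?-merge {X} {Y} {v} simX simY s sv with nonempty? X
  ... | no ¬neX rewrite Empty-unique ¬neX | ∪-identityˡ Y = ε
  ... | yes neX@(x , x∈X) with nonempty? Y
  ...   | no ¬neY rewrite Empty-unique ¬neY | ∪-identityʳ X | ∷?-nonempty {v = v} neX = ε
  ...   | yes neY rewrite ∷?-nonempty {v = v} (x , x∈p∪q⁺ {q = Y} (inj₁ x∈X)) =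
    fwd (merge [] X Y v [] (neX , simX) (neY , simY) sv s) ◅ ε

  ∷?-swap : Simultaneous X → Simultaneous Y → Independent X Y → IsStepSeq Θ v →
            (X ∷? Y ∷? v) ≈ (Y ∷? X ∷? v)
  ∷?-swap {X} {Y} simX simY ind sv = begin
    X ∷? Y ∷? _    ≈⟨ ∷?-merge simX simY (λ a b a∈X b∈Y → proj₁ (ind a b a∈X b∈Y)) sv ⟩
    (X ∪ Y) ∷? _   ≡⟨ cong (_∷? _) (∪-comm X Y) ⟩
    (Y ∪ X) ∷? _   ≈⟨ ∷?-merge simY simX (λ a b a∈Y b∈X → proj₂ (ind b a b∈X a∈Y)) sv ⟨
    Y ∷? X ∷? _    ∎
    where open ≈-Reasoning (setoid (_∼_ Θ))

  independent⇒avoid-one-side : Independent X Y → ¬ Ind Θ a b → (a ∉ Y × b ∉ Y) ⊎ (a ∉ X × b ∉ X)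
  independent⇒avoid-one-side {X} {Y} {a} {b} ind ni with a ∈? Y | b ∈? Y
  ... | no a∉Y  | no b∉Y  = inj₁ (a∉Y , b∉Y)
  ... | yes a∈Y | _       = inj₂ ((λ a∈X → ¬Ind-refl (ind a a a∈X a∈Y)) , (λ b∈X → ni (Ind-sym (ind b a b∈X a∈Y))))
  ... | no _    | yes b∈Y = inj₂ ((λ a∈X → ni (ind a b a∈X b∈Y)) , (λ b∈X → ¬Ind-refl (ind b b b∈X b∈Y)))

  Leads : Step → Word → Set
  Leads A v = ∀ a b → ¬ Ind Θ a b → ∃ λ r → Π⊥ Θ a b v ≡ Πstep Θ a b A ++ r

  leads-[]⇒Empty : Leads A [] → Empty A
  leads-[]⇒Empty h (a , a∈A) with h a a ¬Ind-refl
  ... | r , eq with () ← trans eq (cong (_++ r) (Πstep-diag a∈A))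

  module _ (A B : Step) (v : Word) (h : Leads A (B ∷ v)) where

    independent-A─B×B─A : Independent (A ─ B) (B ─ A)
    independent-A─B×B─A a b a∈A─B b∈B─A with Ind? a b
    ... | yes ind = ind
    ... | no ni with h a b ni
    ...   | r , eq = contradiction (subst (_∈ A) (sym b≡a) (p─q⊆p A B a∈A─B)) (x∈p─q⇒x∉q B A b∈B─A)
      where
      b≡a : b ≡ a
      b≡a = just-injective (∷-injectiveˡ (begin
        just b ∷ Π⊥ Θ a b v      ≡⟨ cong (_++ _) (Πstep-∉∈ (x∈p─q⇒x∉q A B a∈A─B) (p─q⊆p B A b∈B─A)) ⟨
        Π⊥ Θ a b (B ∷ v)         ≡⟨ eq ⟩
        Πstep Θ a b A ++ r       ≡⟨ cong (_++ r) (Πstep-∈∉ (p─q⊆p A B a∈A─B) (x∈p─q⇒x∉q B A b∈B─A)) ⟩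
        just a ∷ r               ∎))
        where open ≡-Reasoning

    serial-A∩B×B─A : Serial (A ∩ B) (B ─ A)
    serial-A∩B×B─A a b a∈A∩B b∈B─A with Ind? a b
    ... | yes (sab , _) = sab
    ... | no ni with h a b ni
    ...   | r , eq = πboth-head a≢b (begin
      πboth a b ++ Π⊥ Θ a b v   ≡⟨ cong (_++ _) (Πstep-∈∈ (proj₂ a∈A×B) (p─q⊆p B A b∈B─A)) ⟨
      Π⊥ Θ a b (B ∷ v)          ≡⟨ eq ⟩
      Πstep Θ a b A ++ r        ≡⟨ cong (_++ r) (Πstep-∈∉ (proj₁ a∈A×B) b∉A) ⟩
      just a ∷ r                ∎)
      where
      open ≡-Reasoning
      a∈A×B : a ∈ A × a ∈ B
      a∈A×B = x∈p∩q⁻ A B a∈A∩B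
      b∉A : b ∉ A
      b∉A = x∈p─q⇒x∉q B A b∈B─A
      a≢b : a ≢ b
      a≢b a≡b = b∉A (subst (_∈ A) a≡b (proj₁ a∈A×B))

    serial-A∩B×A─B : Serial (A ∩ B) (A ─ B)
    serial-A∩B×A─B a b a∈A∩B b∈A─B with Ind? a b
    ... | yes (sab , _) = sab
    ... | no ni with h a b ni
    ...   | r , eq = πboth-head a≢b (begin
      πboth a b ++ r            ≡⟨ cong (_++ r) (Πstep-∈∈ (proj₁ a∈A×B) (p─q⊆p A B b∈A─B)) ⟨
      Πstep Θ a b A ++ r        ≡⟨ eq ⟨
      Π⊥ Θ a b (B ∷ v)          ≡⟨ cong (_++ _) (Πstep-∈∉ (proj₂ a∈A×B) b∉B) ⟩
      just a ∷ Π⊥ Θ a b v       ∎)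
      where
      open ≡-Reasoning
      a∈A×B : a ∈ A × a ∈ B
      a∈A×B = x∈p∩q⁻ A B a∈A∩B
      b∉B : b ∉ B
      b∉B = x∈p─q⇒x∉q A B b∈A─B
      a≢b : a ≢ b
      a≢b a≡b = b∉B (subst (_∈ B) a≡b (proj₂ a∈A×B))

    leads-cancel-A∩B : ∀ a b → ¬ Ind Θ a b →
                       ∃ λ r → Πstep Θ a b (B ─ A) ++ Π⊥ Θ a b v ≡ Πstep Θ a b (A ─ B) ++ r
    leads-cancel-A∩B a b ni with h a b ni
    ... | r , eq = r , ++-cancelˡ (π (A ∩ B)) _ _ (begin
      π (A ∩ B) ++ (π (B ─ A) ++ Π⊥ Θ a b v)  ≡⟨ ++-assoc (π (A ∩ B)) _ _ ⟨
      (π (A ∩ B) ++ π (B ─ A)) ++ Π⊥ Θ a b v  ≡⟨ cong (_++ _) (π-∪ (p∩q∪q─p≡q A B) serial-A∩B×B─A) ⟩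
      π B ++ Π⊥ Θ a b v                        ≡⟨ eq ⟩
      π A ++ r                                 ≡⟨ cong (_++ r) (π-∪ (p∩q∪p─q≡p A B) serial-A∩B×A─B) ⟨
      (π (A ∩ B) ++ π (A ─ B)) ++ r            ≡⟨ ++-assoc (π (A ∩ B)) _ _ ⟩
      π (A ∩ B) ++ (π (A ─ B) ++ r)            ∎)
      where
      open ≡-Reasoning
      π : Step → List (Maybe (Letter Θ))
      π = Πstep Θ a b
      π-∪ : ∀ {X Y Z : Step} → X ∪ Y ≡ Z → Serial X Y → π X ++ π Y ≡ π Z
      π-∪ refl = Πstep-∪ ni

    leads-A─B : Leads (A ─ B) v
    leads-A─B a b ni with leads-cancel-A∩B a b ni | independent⇒avoid-one-side independent-A─B×B─A ni
    ... | r , eq | inj₁ (a∉B─A , b∉B─A) = r , trans (cong (_++ _) (sym (Πstep-∉∉ a∉B─A b∉B─A))) eq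
    ... | _      | inj₂ (a∉A─B , b∉A─B) = Π⊥ Θ a b v , cong (_++ _) (sym (Πstep-∉∉ a∉A─B b∉A─B))

  lead-to-front : Simultaneous A → IsStepSeq Θ v → Leads A v →
                  ∃ λ v′ → IsStepSeq Θ v′ × v ≈ (A ∷? v′)
  lead-to-front {A} {[]} _ [] h = [] , [] , subst ([] ≈_) (sym (∷?-empty (leads-[]⇒Empty h))) ε
  lead-to-front {A} {B ∷ v} simA (sB@(neB , simB) ∷ sv) h
    with lead-to-front (Simultaneous-─ simA) sv (leads-A─B A B v h)
  ... | v₂ , sv₂ , v≈A─B∷v₂ = (B ─ A) ∷? v₂ , ∷?-IsStepSeq simD sv₂ , (begin
    B ∷ v                                ≈⟨ ≈-∷ sB v≈A─B∷v₂ ⟩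
    B ∷ (A ─ B) ∷? v₂                    ≡⟨ cong (_∷ (A ─ B) ∷? v₂) (p∩q∪q─p≡q A B) ⟨
    (A ∩ B ∪ (B ─ A)) ∷ (A ─ B) ∷? v₂    ≡⟨ ∷?-nonempty (subst Nonempty (sym (p∩q∪q─p≡q A B)) neB) ⟨
    (A ∩ B ∪ (B ─ A)) ∷? (A ─ B) ∷? v₂   ≈⟨ ∷?-merge simC simD (serial-A∩B×B─A A B v h) (∷?-IsStepSeq simE sv₂) ⟨
    A ∩ B ∷? (B ─ A) ∷? (A ─ B) ∷? v₂    ≈⟨ ≈-∷? simC (∷?-swap simE simD (independent-A─B×B─A A B v h) sv₂) ⟨
    A ∩ B ∷? (A ─ B) ∷? (B ─ A) ∷? v₂    ≈⟨ ∷?-merge simC simE (serial-A∩B×A─B A B v h) (∷?-IsStepSeq simD sv₂) ⟩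
    (A ∩ B ∪ (A ─ B)) ∷? (B ─ A) ∷? v₂   ≡⟨ cong (_∷? (B ─ A) ∷? v₂) (p∩q∪p─q≡p A B) ⟩
    A ∷? (B ─ A) ∷? v₂                   ∎)
    where
    open ≈-Reasoning (setoid (_∼_ Θ))
    simC : Simultaneous (A ∩ B)
    simC = Simultaneous-∩ simA
    simD : Simultaneous (B ─ A)
    simD = Simultaneous-─ simB
    simE : Simultaneous (A ─ B)
    simE = Simultaneous-─ simA

  complete : IsStepSeq Θ w → IsStepSeq Θ u →
             (∀ a b → ¬ Ind Θ a b → Π⊥ Θ a b w ≡ Π⊥ Θ a b u) → w ≈ u
  complete [] [] _ = ε
  complete [] ((neB , _) ∷ _) h = ⊥-elim (leads-[]⇒Empty (λ a b ni → _ , h a b ni) neB)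
  complete {A ∷ w} {u} ((neA , simA) ∷ sw) su h
    with lead-to-front simA su (λ a b ni → Π⊥ Θ a b w , sym (h a b ni))
  ... | u′ , su′ , u≈A∷?u′ = begin
    A ∷ w    ≈⟨ ≈-∷ (neA , simA) (complete sw su′ Π-w≡Π-u′) ⟩
    A ∷ u′   ≡⟨ ∷?-nonempty neA ⟨
    A ∷? u′  ≈⟨ u≈A∷?u′ ⟨
    u        ∎
    where
    open ≈-Reasoning (setoid (_∼_ Θ))
    u≈A∷u′ : u ≈ (A ∷ u′)
    u≈A∷u′ = subst (u ≈_) (∷?-nonempty neA) u≈A∷?u′
    Π-w≡Π-u′ : ∀ a b → ¬ Ind Θ a b → Π⊥ Θ a b w ≡ Π⊥ Θ a b u′
    Π-w≡Π-u′ a b ni = ++-cancelˡ (Πstep Θ a b A) _ _ (trans (h a b ni) (Π⊥-≈ ni u≈A∷u′))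

theorem4p1 : ∀ {m : ℕ} (Θ : ComtraceAlphabet m) (w u : List (Subset (suc m))) →
    IsStepSeq Θ w → IsStepSeq Θ u →
    (_≡Θ_ Θ w u ⇔ (∀ a b → ¬ Ind Θ a b → Π⊥ Θ a b w ≡ Π⊥ Θ a b u))
theorem4p1 Θ w u sw su = mk⇔ (λ w≈u a b ni → Π⊥-≈ Θ ni w≈u) (complete Θ sw su)
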